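{- Let $n,x,y$ be nonnegative integers with $x,y\le n$, let $H=|X\cap Y|$ where $X\subseteq[n]$ is a uniformly random subset of size $x$ and $Y\subseteq[n]$ is a fixed subset of size $y$, and let $B$ be a binomial random variable with parameters $(x,\,y/n)$. If $x\le\sqrt n$ then for every integer $0\le h\le x$ we have $\Pr[H=h]\le2\Pr[B=h]$. -}

module Defs where

open import Data.Nat as ℕ using (ℕ; zero; suc; _∸_)
open import Data.Nat.Combinatorics using (_C_)
open import Data.Integer using (+_)
open import Data.Rational using (ℚ; _/_; _*_; _-_; 0ℚ; 1ℚ)
open import Data.Bool using (Bool; true; false)
open import Data.List using (List; []; _∷_; _++_; map; filter; length)
open import Data.Vec using (_∷_; [])
open import Data.Fin.Subset using (Subset; _∩_; ∣_∣)
open import Relation.Binary.PropositionalEquality using (_≡_)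
open import Data.Nat.Properties using (_≟_)
open import Data.Product using (_×_)
open import Relation.Nullary.Decidable using (_×-dec_)

-- natural-number fraction a / d as a rational; a / 0 is set to 0 by
-- convention (never used with d = 0 in the lemma)
frac : ℕ → ℕ → ℚ
frac a zero    = 0ℚ
frac a (suc d) = (+ a) / (suc d)

_^ℚ_ : ℚ → ℕ → ℚ
q ^ℚ zero  = 1ℚ
q ^ℚ suc k = q * (q ^ℚ k)

allSubsets : (n : ℕ) → List (Subset n)
allSubsets zero    = [] ∷ []
allSubsets (suc n) = map (false ∷_) (allSubsets n) ++ map (true ∷_) (allSubsets n)

subsetsOfSize : (n x : ℕ) → List (Subset n)
subsetsOfSize n x = filter (λ X → ∣ X ∣ ≟ x) (allSubsets n)

-- Pr[ |X ∩ Y| = h ] for X uniform among the x-subsets of [n], Y fixed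
hyperProb : (n x : ℕ) → Subset n → ℕ → ℚ
hyperProb n x Y h =
  frac (length (filter (λ X → ∣ X ∩ Y ∣ ≟ h) (subsetsOfSize n x)))
       (length (subsetsOfSize n x))

binomProb : ℕ → ℚ → ℕ → ℚ
binomProb m p h = ((+ (m C h)) / 1) * ((p ^ℚ h) * ((1ℚ - p) ^ℚ (m ∸ h)))

module Submission where

-- Pr[H = h] = C(y,h) C(n−y,x−h) / C(n,x) and Pr[B = h] = C(x,h) yʰ (n−y)ˣ⁻ʰ / nˣ.
-- Multiplying through by h! (x−h)! and using x! = C(x,h) h! (x−h)!, C(m,k) k! = m(m−1)⋯(m−k+1) ≤ mᵏ,
-- the claim reduces to nˣ ≤ 2 n(n−1)⋯(n−x+1). This is the Weierstrass product inequality
-- ∏_{i<x} (1 − i/n) ≥ 1 − C(x,2)/n, whose right-hand side is at least 1/2 when x² ≤ n.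

open import Defs
open import Data.Bool using (true; false)
open import Data.Fin.Subset using (Subset; _∩_; _─_; ∁; ∣_∣)
open import Data.Fin.Subset.Properties using (∣∁p∣≡n∸∣p∣)
open import Data.Integer as ℤ using (+_)
import Data.Integer.Properties as ℤ
import Data.Integer.Tactic.RingSolver as ℤ
open import Data.List using ([]; _∷_; _++_; map; filter; length)
open import Data.List.Properties using (filter-++; length-++; length-map; filter-≐; filter-none)
open import Data.List.Relation.Unary.All using (universal)
open import Data.Nat using (ℕ; zero; suc; _+_; _*_; _∸_; _^_; _!; _≤_; _<_; z≤n; s≤s; NonZero; >-nonZero⁻¹)
open import Data.Nat.Properties
open import Data.Nat.Combinatorics
  using (_C_; _P_; nCk≡nPk/k!; nPk≡n!/[n∸k]!; nCk≡n!/k![n-k]!; k![n∸k]!∣n!; k>n⇒nCk≡0; nCk+nC[k+1]≡[n+1]C[k+1]; nC1≡n)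
open import Data.Nat.Combinatorics.Base using (_P′_)
open import Data.Nat.Combinatorics.Specification using (nP′k≡n!/[n∸k]!; k!∣nP′k)
import Data.Nat.DivMod as ℕ
open import Data.Nat.Tactic.RingSolver using (solve-∀)
open import Data.Product using (_,_; _×_; map₁; map₂)
open import Data.Rational as ℚ using (_/_; toℚᵘ) renaming (_≤_ to _≤ℚ_; _*_ to _*ℚ_)
import Data.Rational.Properties as ℚ
open import Data.Rational.Unnormalised as ℚᵘ using (mkℚᵘ; _≃_; *≡*; *≤*)
import Data.Rational.Unnormalised.Properties as ℚᵘ
open import Algebra.Properties.AbelianGroup ℚ.+-0-abelianGroup using (xyx⁻¹≈y)
open import Data.Vec using (_∷_; [])
open import Function using (_∘_)
open import Level using (Level)
open import Relation.Nullary using (yes; no)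
open import Relation.Nullary.Decidable using (does; _×-dec_)
open import Relation.Unary using (Pred; Decidable; _≐_; Empty)
open import Relation.Unary.Properties using (_∩?_)
open import Relation.Binary.PropositionalEquality

filter-map : ∀ {a b p} {A : Set a} {B : Set b} {P : Pred B p} (P? : Decidable P) (f : A → B) xs →
             filter P? (map f xs) ≡ map f (filter (P? ∘ f) xs)
filter-map P? f [] = refl
filter-map P? f (x ∷ xs) with does (P? (f x))
... | true  = cong (f x ∷_) (filter-map P? f xs)
... | false = filter-map P? f xs

filter-filter : ∀ {a p q} {A : Set a} {P : Pred A p} {Q : Pred A q} (P? : Decidable P) (Q? : Decidable Q) xs →
                filter Q? (filter P? xs) ≡ filter (P? ∩? Q?) xs
filter-filter P? Q? [] = refl
filter-filter P? Q? (x ∷ xs) with does (P? x)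
... | false = filter-filter P? Q? xs
... | true with does (Q? x)
...   | true  = cong (x ∷_) (filter-filter P? Q? xs)
...   | false = filter-filter P? Q? xs

nC[k+1]+nCk≡[n+1]C[k+1] : ∀ n k → n C suc k + n C k ≡ suc n C suc k
nC[k+1]+nCk≡[n+1]C[k+1] n k = trans (+-comm (n C suc k) (n C k)) (nCk+nC[k+1]≡[n+1]C[k+1] n k)

module _ (n : ℕ) {ℓ : Level} where

  countSubsets : {P : Pred (Subset n) ℓ} → Decidable P → ℕ
  countSubsets P? = length (filter P? (allSubsets n))

  countSubsets-≐ : {P Q : Pred (Subset n) ℓ} (P? : Decidable P) (Q? : Decidable Q) →
                   P ≐ Q → countSubsets P? ≡ countSubsets Q?
  countSubsets-≐ P? Q? P≐Q = cong length (filter-≐ P? Q? P≐Q (allSubsets n))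

  countSubsets-empty : {P : Pred (Subset n) ℓ} (P? : Decidable P) → Empty P → countSubsets P? ≡ 0
  countSubsets-empty P? ∅ = cong length (filter-none P? (universal ∅ (allSubsets n)))

countSubsets-suc : ∀ {n ℓ} {P : Pred (Subset (suc n)) ℓ} (P? : Decidable P) →
  countSubsets (suc n) P? ≡ countSubsets n (P? ∘ (false ∷_)) + countSubsets n (P? ∘ (true ∷_))
countSubsets-suc {n} P? = begin
  length (filter P? (map (false ∷_) S ++ map (true ∷_) S))
    ≡⟨ cong length (filter-++ P? (map (false ∷_) S) (map (true ∷_) S)) ⟩
  length (filter P? (map (false ∷_) S) ++ filter P? (map (true ∷_) S))
    ≡⟨ length-++ (filter P? (map (false ∷_) S)) ⟩
  length (filter P? (map (false ∷_) S)) + length (filter P? (map (true ∷_) S))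
    ≡⟨ cong₂ _+_ (length-filter-map (false ∷_)) (length-filter-map (true ∷_)) ⟩
  countSubsets n (P? ∘ (false ∷_)) + countSubsets n (P? ∘ (true ∷_)) ∎
  where
  open ≡-Reasoning
  S = allSubsets n
  length-filter-map : (f : Subset n → Subset (suc n)) →
                      length (filter P? (map f S)) ≡ length (filter (P? ∘ f) S)
  length-filter-map f = trans (cong length (filter-map P? f S)) (length-map f (filter (P? ∘ f) S))

countSubsets-size : ∀ n k → countSubsets n (λ X → ∣ X ∣ ≟ k) ≡ n C k
countSubsets-size zero    zero    = refl
countSubsets-size zero    (suc k) = sym (k>n⇒nCk≡0 {0} {suc k} (s≤s z≤n))
countSubsets-size (suc n) k       = trans (countSubsets-suc {n} (λ X → ∣ X ∣ ≟ k)) (shift k)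
  where
  shift : ∀ k → countSubsets n (λ X → ∣ X ∣ ≟ k) + countSubsets n (λ X → suc ∣ X ∣ ≟ k) ≡ suc n C k
  shift zero    = cong₂ _+_ (countSubsets-size n 0) (countSubsets-empty n (λ X → suc ∣ X ∣ ≟ 0) λ _ ())
  shift (suc k) = begin
    countSubsets n (λ X → ∣ X ∣ ≟ suc k) + countSubsets n (λ X → suc ∣ X ∣ ≟ suc k)
      ≡⟨ cong₂ _+_ (countSubsets-size n (suc k)) (countSubsets-≐ n _ _ (suc-injective , cong suc)) ⟩
    n C suc k + countSubsets n (λ X → ∣ X ∣ ≟ k)
      ≡⟨ cong (λ t → n C suc k + t) (countSubsets-size n k) ⟩
    n C suc k + n C k
      ≡⟨ nC[k+1]+nCk≡[n+1]C[k+1] n k ⟩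
    suc n C suc k ∎
    where open ≡-Reasoning

splits? : ∀ {n} (Y : Subset n) (a b : ℕ) → Decidable (λ X → ∣ X ∩ Y ∣ ≡ a × ∣ X ─ Y ∣ ≡ b)
splits? Y a b X = (∣ X ∩ Y ∣ ≟ a) ×-dec (∣ X ─ Y ∣ ≟ b)

countSubsets-splits : ∀ {n} (Y : Subset n) a b → countSubsets n (splits? Y a b) ≡ (∣ Y ∣ C a) * (∣ ∁ Y ∣ C b)
countSubsets-splits []      zero    zero    = refl
countSubsets-splits []      zero    (suc b) = cong ((0 C 0) *_) (sym (k>n⇒nCk≡0 {0} {suc b} (s≤s z≤n)))
countSubsets-splits []      (suc a) b       = refl
countSubsets-splits {suc n} (true ∷ Y) a b =
  trans (countSubsets-suc {n} (splits? (true ∷ Y) a b)) (shift a)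
  where
  c = ∣ ∁ Y ∣ C b
  shift : ∀ a → countSubsets n (splits? Y a b) + countSubsets n (splits? (true ∷ Y) a b ∘ (true ∷_))
                ≡ (suc ∣ Y ∣ C a) * c
  shift zero    = trans (cong₂ _+_ (countSubsets-splits Y 0 b) (countSubsets-empty n _ λ _ ()))
                        (+-identityʳ (1 * c))
  shift (suc a) = begin
    countSubsets n (splits? Y (suc a) b) + countSubsets n (splits? (true ∷ Y) (suc a) b ∘ (true ∷_))
      ≡⟨ cong₂ _+_ (countSubsets-splits Y (suc a) b)
                   (countSubsets-≐ n _ (splits? Y a b) (map₁ suc-injective , map₁ (cong suc))) ⟩
    (∣ Y ∣ C suc a) * c + countSubsets n (splits? Y a b)
      ≡⟨ cong (λ t → (∣ Y ∣ C suc a) * c + t) (countSubsets-splits Y a b) ⟩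
    (∣ Y ∣ C suc a) * c + (∣ Y ∣ C a) * c
      ≡⟨ *-distribʳ-+ c (∣ Y ∣ C suc a) (∣ Y ∣ C a) ⟨
    (∣ Y ∣ C suc a + ∣ Y ∣ C a) * c
      ≡⟨ cong (_* c) (nC[k+1]+nCk≡[n+1]C[k+1] ∣ Y ∣ a) ⟩
    (suc ∣ Y ∣ C suc a) * c ∎
    where open ≡-Reasoning
countSubsets-splits {suc n} (false ∷ Y) a b =
  trans (countSubsets-suc {n} (splits? (false ∷ Y) a b)) (shift b)
  where
  c = ∣ Y ∣ C a
  shift : ∀ b → countSubsets n (splits? Y a b) + countSubsets n (splits? (false ∷ Y) a b ∘ (true ∷_))
                ≡ c * (suc ∣ ∁ Y ∣ C b)
  shift zero    = trans (cong₂ _+_ (countSubsets-splits Y a 0) (countSubsets-empty n _ λ _ ()))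
                        (+-identityʳ (c * 1))
  shift (suc b) = begin
    countSubsets n (splits? Y a (suc b)) + countSubsets n (splits? (false ∷ Y) a (suc b) ∘ (true ∷_))
      ≡⟨ cong₂ _+_ (countSubsets-splits Y a (suc b))
                   (countSubsets-≐ n _ (splits? Y a b) (map₂ suc-injective , map₂ (cong suc))) ⟩
    c * (∣ ∁ Y ∣ C suc b) + countSubsets n (splits? Y a b)
      ≡⟨ cong (λ t → c * (∣ ∁ Y ∣ C suc b) + t) (countSubsets-splits Y a b) ⟩
    c * (∣ ∁ Y ∣ C suc b) + c * (∣ ∁ Y ∣ C b)
      ≡⟨ *-distribˡ-+ c (∣ ∁ Y ∣ C suc b) (∣ ∁ Y ∣ C b) ⟨
    c * (∣ ∁ Y ∣ C suc b + ∣ ∁ Y ∣ C b)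
      ≡⟨ cong (c *_) (nC[k+1]+nCk≡[n+1]C[k+1] ∣ ∁ Y ∣ b) ⟩
    c * (suc ∣ ∁ Y ∣ C suc b) ∎
    where open ≡-Reasoning

∣p∣≡∣p∩q∣+∣p─q∣ : ∀ {n} (p q : Subset n) → ∣ p ∣ ≡ ∣ p ∩ q ∣ + ∣ p ─ q ∣
∣p∣≡∣p∩q∣+∣p─q∣ []          []          = refl
∣p∣≡∣p∩q∣+∣p─q∣ (false ∷ p) (true ∷ q)  = ∣p∣≡∣p∩q∣+∣p─q∣ p q
∣p∣≡∣p∩q∣+∣p─q∣ (false ∷ p) (false ∷ q) = ∣p∣≡∣p∩q∣+∣p─q∣ p q
∣p∣≡∣p∩q∣+∣p─q∣ (true ∷ p)  (true ∷ q)  = cong suc (∣p∣≡∣p∩q∣+∣p─q∣ p q)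
∣p∣≡∣p∩q∣+∣p─q∣ (true ∷ p)  (false ∷ q) = trans (cong suc (∣p∣≡∣p∩q∣+∣p─q∣ p q)) (sym (+-suc _ _))

size-∩≐splits : ∀ {n x h} (Y : Subset n) → h ≤ x →
  (λ X → ∣ X ∣ ≡ x × ∣ X ∩ Y ∣ ≡ h) ≐ (λ X → ∣ X ∩ Y ∣ ≡ h × ∣ X ─ Y ∣ ≡ x ∸ h)
size-∩≐splits {x = x} {h} Y h≤x = (λ {X} → to (∣p∣≡∣p∩q∣+∣p─q∣ X Y)) , (λ {X} → from (∣p∣≡∣p∩q∣+∣p─q∣ X Y))
  where
  to : ∀ {s i d} → s ≡ i + d → s ≡ x × i ≡ h → i ≡ h × d ≡ x ∸ h
  to {i = i} {d} x≡h+d (refl , refl) = refl , sym (trans (cong (_∸ i) x≡h+d) (m+n∸m≡n i d))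
  from : ∀ {s i d} → s ≡ i + d → i ≡ h × d ≡ x ∸ h → s ≡ x × i ≡ h
  from s≡h+[x∸h] (refl , refl) = trans s≡h+[x∸h] (m+[n∸m]≡n h≤x) , refl

hyperProb-formula : ∀ {n} x h (Y : Subset n) → h ≤ x →
  hyperProb n x Y h ≡ frac ((∣ Y ∣ C h) * (∣ ∁ Y ∣ C (x ∸ h))) (n C x)
hyperProb-formula {n} x h Y h≤x = cong₂ frac favourable (countSubsets-size n x)
  where
  open ≡-Reasoning
  favourable : length (filter (λ X → ∣ X ∩ Y ∣ ≟ h) (subsetsOfSize n x)) ≡ (∣ Y ∣ C h) * (∣ ∁ Y ∣ C (x ∸ h))
  favourable = begin
    length (filter (λ X → ∣ X ∩ Y ∣ ≟ h) (filter (λ X → ∣ X ∣ ≟ x) (allSubsets n)))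
      ≡⟨ cong length (filter-filter (λ X → ∣ X ∣ ≟ x) (λ X → ∣ X ∩ Y ∣ ≟ h) (allSubsets n)) ⟩
    countSubsets n ((λ X → ∣ X ∣ ≟ x) ∩? (λ X → ∣ X ∩ Y ∣ ≟ h))
      ≡⟨ countSubsets-≐ n _ (splits? Y h (x ∸ h)) (size-∩≐splits Y h≤x) ⟩
    countSubsets n (splits? Y h (x ∸ h))
      ≡⟨ countSubsets-splits Y h (x ∸ h) ⟩
    (∣ Y ∣ C h) * (∣ ∁ Y ∣ C (x ∸ h)) ∎

nCk*k!≡nP′k : ∀ {n k} → k ≤ n → (n C k) * k ! ≡ n P′ k
nCk*k!≡nP′k {n} {k} k≤n = begin
  (n C k) * k !              ≡⟨ cong (_* k !) (nCk≡nPk/k! k≤n) ⟩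
  ((n P k) ℕ./ k !) * k !    ≡⟨ cong (λ m → (m ℕ./ k !) * k !) nPk≡nP′k ⟩
  ((n P′ k) ℕ./ k !) * k !   ≡⟨ ℕ.m/n*n≡m (k!∣nP′k k≤n) ⟩
  n P′ k                     ∎
  where
  open ≡-Reasoning
  instance _ = k !≢0
  nPk≡nP′k : n P k ≡ n P′ k
  nPk≡nP′k = trans (nPk≡n!/[n∸k]! k≤n) (sym (nP′k≡n!/[n∸k]! k≤n))

nCk*[k!*[n∸k]!]≡n! : ∀ {n k} → k ≤ n → (n C k) * (k ! * (n ∸ k) !) ≡ n !
nCk*[k!*[n∸k]!]≡n! {n} {k} k≤n =
  trans (cong (_* (k ! * (n ∸ k) !)) (nCk≡n!/k![n-k]! k≤n)) (ℕ.m/n*n≡m (k![n∸k]!∣n! k≤n))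
  where instance _ = k !* (n ∸ k) !≢0

nCk>0 : ∀ {n k} → k ≤ n → 0 < n C k
nCk>0 {n} {k} k≤n = >-nonZero⁻¹ (n C k) {{m*n≢0⇒m≢0 (n C k) {{nonZero}}}}
  where
  nonZero : NonZero ((n C k) * (k ! * (n ∸ k) !))
  nonZero = subst NonZero (sym (nCk*[k!*[n∸k]!]≡n! k≤n)) (n !≢0)

nP′k≤n^k : ∀ n k → n P′ k ≤ n ^ k
nP′k≤n^k n zero    = ≤-refl
nP′k≤n^k n (suc k) = *-mono-≤ (m∸n≤m n k) (nP′k≤n^k n k)

nCk*k!≤n^k : ∀ n k → (n C k) * k ! ≤ n ^ k
nCk*k!≤n^k n k with k ≤? n
... | yes k≤n = subst (_≤ n ^ k) (sym (nCk*k!≡nP′k k≤n)) (nP′k≤n^k n k)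
... | no  k≰n = subst (λ c → c * k ! ≤ n ^ k) (sym (k>n⇒nCk≡0 (≰⇒> k≰n))) z≤n

[k+1]C2≡k+kC2 : ∀ k → suc k C 2 ≡ k + k C 2
[k+1]C2≡k+kC2 k = trans (sym (nCk+nC[k+1]≡[n+1]C[k+1] k 1)) (cong (λ t → t + k C 2) (nC1≡n k))

nP′k-weierstrass : ∀ {n} k → k ≤ n → n * n ^ k ≤ n * (n P′ k) + (k C 2) * n ^ k
nP′k-weierstrass {n} zero    _   = m≤m+n (n * 1) ((0 C 2) * 1)
nP′k-weierstrass {n} (suc k) k<n = begin
  n * (n * nᵏ)                                   ≤⟨ *-monoʳ-≤ n (nP′k-weierstrass k k≤n) ⟩
  n * (n * nPk + kC2 * nᵏ)                       ≡⟨ distrib n nPk kC2 nᵏ ⟩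
  n * (n * nPk) + kC2 * (n * nᵏ)                 ≤⟨ +-monoˡ-≤ (kC2 * (n * nᵏ)) (*-monoʳ-≤ n n*nPk≤) ⟩
  n * ((n ∸ k) * nPk + k * nᵏ) + kC2 * (n * nᵏ)  ≡⟨ regroup n (n ∸ k) nPk k nᵏ kC2 ⟩
  n * ((n ∸ k) * nPk) + (k + kC2) * (n * nᵏ)     ≡⟨ cong (λ t → n * ((n ∸ k) * nPk) + t * (n * nᵏ)) ([k+1]C2≡k+kC2 k) ⟨
  n * ((n ∸ k) * nPk) + (suc k C 2) * (n * nᵏ)   ∎
  where
  open ≤-Reasoning
  k≤n = <⇒≤ k<n
  nPk = n P′ k
  nᵏ  = n ^ k
  kC2 = k C 2
  n*nPk≤ : n * nPk ≤ (n ∸ k) * nPk + k * nᵏ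
  n*nPk≤ = begin
    n * nPk                  ≡⟨ cong (_* nPk) (m∸n+n≡m k≤n) ⟨
    (n ∸ k + k) * nPk        ≡⟨ *-distribʳ-+ nPk (n ∸ k) k ⟩
    (n ∸ k) * nPk + k * nPk  ≤⟨ +-monoʳ-≤ ((n ∸ k) * nPk) (*-monoʳ-≤ k (nP′k≤n^k n k)) ⟩
    (n ∸ k) * nPk + k * nᵏ   ∎
  distrib : ∀ n f c p → n * (n * f + c * p) ≡ n * (n * f) + c * (n * p)
  distrib = solve-∀
  regroup : ∀ n d f k p c → n * (d * f + k * p) + c * (n * p) ≡ n * (d * f) + (k + c) * (n * p)
  regroup = solve-∀

n^k≤2*nP′k : ∀ {n k} → k * k ≤ n → k ≤ n → n ^ k ≤ 2 * (n P′ k)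
n^k≤2*nP′k {zero}  _     z≤n = s≤s z≤n
n^k≤2*nP′k {suc m} {k} k*k≤n k≤n = *-cancelˡ-≤ n (+-cancelʳ-≤ (n * nᵏ) (n * nᵏ) (n * (2 * nPk)) (begin
  n * nᵏ + n * nᵏ                              ≤⟨ +-mono-≤ weierstrass weierstrass ⟩
  (n * nPk + kC2 * nᵏ) + (n * nPk + kC2 * nᵏ)  ≡⟨ double n nPk kC2 nᵏ ⟩
  n * (2 * nPk) + (kC2 * 2) * nᵏ               ≤⟨ +-monoʳ-≤ (n * (2 * nPk)) (*-monoˡ-≤ nᵏ (≤-trans kC2*2≤k*k k*k≤n)) ⟩
  n * (2 * nPk) + n * nᵏ                       ∎))
  where
  open ≤-Reasoning
  n   = suc m
  nPk = n P′ k
  nᵏ  = n ^ k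
  kC2 = k C 2
  weierstrass : n * nᵏ ≤ n * nPk + kC2 * nᵏ
  weierstrass = nP′k-weierstrass k k≤n
  kC2*2≤k*k : kC2 * 2 ≤ k * k
  kC2*2≤k*k = subst (kC2 * 2 ≤_) (cong (k *_) (*-identityʳ k)) (nCk*k!≤n^k k 2)
  double : ∀ n f c p → (n * f + c * p) + (n * f + c * p) ≡ n * (2 * f) + (c * 2) * p
  double = solve-∀

hypergeometric≤2*binomial : ∀ {n x} y z h → x * x ≤ n → x ≤ n → h ≤ x →
  (y C h) * (z C (x ∸ h)) * n ^ x ≤ 2 * ((x C h) * (y ^ h * z ^ (x ∸ h))) * (n C x)
hypergeometric≤2*binomial {n} {x} y z h x*x≤n x≤n h≤x =
  *-cancelʳ-≤ _ _ (h ! * b !) {{h !* b !≢0}} (begin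
    (y C h) * (z C b) * n ^ x * (h ! * b !)          ≡⟨ regroup (y C h) (z C b) (n ^ x) (h !) (b !) ⟩
    ((y C h) * h !) * ((z C b) * b !) * n ^ x        ≤⟨ *-mono-≤ (*-mono-≤ (nCk*k!≤n^k y h) (nCk*k!≤n^k z b))
                                                                (n^k≤2*nP′k x*x≤n x≤n) ⟩
    y ^ h * z ^ b * (2 * (n P′ x))                   ≡⟨ cong (λ t → y ^ h * z ^ b * (2 * t)) nP′x≡ ⟩
    y ^ h * z ^ b * (2 * ((n C x) * ((x C h) * (h ! * b !))))
                                                     ≡⟨ regroup′ (y ^ h) (z ^ b) (n C x) (x C h) (h ! * b !) ⟩
    2 * ((x C h) * (y ^ h * z ^ b)) * (n C x) * (h ! * b !) ∎)
  where
  open ≤-Reasoning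
  b = x ∸ h
  nP′x≡ : n P′ x ≡ (n C x) * ((x C h) * (h ! * b !))
  nP′x≡ = trans (sym (nCk*k!≡nP′k x≤n)) (cong ((n C x) *_) (sym (nCk*[k!*[n∸k]!]≡n! h≤x)))
  regroup : ∀ c d p f g → c * d * p * (f * g) ≡ (c * f) * (d * g) * p
  regroup = solve-∀
  regroup′ : ∀ p q r s t → p * q * (2 * (r * (s * t))) ≡ 2 * (s * (p * q)) * r * t
  regroup′ = solve-∀

toℚᵘ-frac : ∀ a d → toℚᵘ (frac a (suc d)) ≃ mkℚᵘ (+ a) d
toℚᵘ-frac a d = ℚ.toℚᵘ-fromℚᵘ (mkℚᵘ (+ a) d)

frac-* : ∀ a b c d → frac a b *ℚ frac c d ≡ frac (a * c) (b * d)
frac-* a zero    c d       = ℚ.*-zeroˡ (frac c d)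
frac-* a (suc b) c zero    rewrite *-zeroʳ b = ℚ.*-zeroʳ (frac a (suc b))
frac-* a (suc b) c (suc d) = ℚ.toℚᵘ-injective (begin
  toℚᵘ (frac a (suc b) *ℚ frac c (suc d))           ≈⟨ ℚ.toℚᵘ-homo-* (frac a (suc b)) (frac c (suc d)) ⟩
  toℚᵘ (frac a (suc b)) ℚᵘ.* toℚᵘ (frac c (suc d))  ≈⟨ ℚᵘ.*-cong (toℚᵘ-frac a b) (toℚᵘ-frac c d) ⟩
  mkℚᵘ (+ a) b ℚᵘ.* mkℚᵘ (+ c) d                    ≈⟨ *≡* (cong (ℤ._* + suc (d + b * suc d)) (sym (ℤ.pos-* a c))) ⟩
  mkℚᵘ (+ (a * c)) (d + b * suc d)                  ≈⟨ toℚᵘ-frac (a * c) _ ⟨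
  toℚᵘ (frac (a * c) (suc b * suc d))               ∎)
  where open ℚᵘ.≃-Reasoning

frac-^ : ∀ a b k → frac a b ^ℚ k ≡ frac (a ^ k) (b ^ k)
frac-^ a b zero    = refl
frac-^ a b (suc k) = trans (cong (frac a b *ℚ_) (frac-^ a b k)) (frac-* a b (a ^ k) (b ^ k))

frac-+ : ∀ a c d → frac a (suc d) ℚ.+ frac c (suc d) ≡ frac (a + c) (suc d)
frac-+ a c d = ℚ.toℚᵘ-injective (begin
  toℚᵘ (frac a (suc d) ℚ.+ frac c (suc d))          ≈⟨ ℚ.toℚᵘ-homo-+ (frac a (suc d)) (frac c (suc d)) ⟩
  toℚᵘ (frac a (suc d)) ℚᵘ.+ toℚᵘ (frac c (suc d))  ≈⟨ ℚᵘ.+-cong (toℚᵘ-frac a d) (toℚᵘ-frac c d) ⟩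
  mkℚᵘ (+ a) d ℚᵘ.+ mkℚᵘ (+ c) d                    ≈⟨ *≡* (trans (common-denominator (+ a) (+ c) (+ suc d))
                                                         (cong₂ ℤ._*_ (sym (ℤ.pos-+ a c)) (sym (ℤ.pos-* (suc d) (suc d))))) ⟩
  mkℚᵘ (+ (a + c)) d                                ≈⟨ toℚᵘ-frac (a + c) d ⟨
  toℚᵘ (frac (a + c) (suc d))                       ∎)
  where
  open ℚᵘ.≃-Reasoning
  common-denominator : ∀ a c d → (a ℤ.* d ℤ.+ c ℤ.* d) ℤ.* d ≡ (a ℤ.+ c) ℤ.* (d ℤ.* d)
  common-denominator = ℤ.solve-∀

frac-n-n≡1 : ∀ m → frac (suc m) (suc m) ≡ ℚ.1ℚ
frac-n-n≡1 m = ℚ.toℚᵘ-injective (ℚᵘ.≃-trans (toℚᵘ-frac (suc m) m) (*≡* (ℤ.*-comm (+ suc m) (+ 1))))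

1-frac : ∀ {y m} → y ≤ suc m → ℚ.1ℚ ℚ.- frac y (suc m) ≡ frac (suc m ∸ y) (suc m)
1-frac {y} {m} y≤n = begin
  ℚ.1ℚ ℚ.- p     ≡⟨ cong (ℚ._- p) p+q≡1 ⟨
  p ℚ.+ q ℚ.- p  ≡⟨ xyx⁻¹≈y p q ⟩
  q              ∎
  where
  open ≡-Reasoning
  p = frac y (suc m)
  q = frac (suc m ∸ y) (suc m)
  p+q≡1 : p ℚ.+ q ≡ ℚ.1ℚ
  p+q≡1 = trans (frac-+ y (suc m ∸ y) m) (trans (cong (λ a → frac a (suc m)) (m+[n∸m]≡n y≤n)) (frac-n-n≡1 m))

frac-mono-≤ : ∀ {a b c d} → 0 < b → 0 < d → a * d ≤ c * b → frac a b ≤ℚ frac c d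
frac-mono-≤ {a} {suc b} {c} {suc d} _ _ ad≤cb = ℚ.toℚᵘ-cancel-≤
  (ℚᵘ.≤-respˡ-≃ (ℚᵘ.≃-sym (toℚᵘ-frac a b)) (ℚᵘ.≤-respʳ-≃ (ℚᵘ.≃-sym (toℚᵘ-frac c d))
    (*≤* (subst₂ ℤ._≤_ (ℤ.pos-* a (suc d)) (ℤ.pos-* c (suc b)) (ℤ.+≤+ ad≤cb)))))

frac-scale : ∀ k a d → frac k 1 *ℚ frac a d ≡ frac (k * a) d
frac-scale k a d = trans (frac-* k 1 a d) (cong (frac (k * a)) (*-identityˡ d))

binomProb-formula : ∀ {m x y h} → y ≤ suc m → h ≤ x →
  binomProb x (frac y (suc m)) h ≡ frac ((x C h) * (y ^ h * (suc m ∸ y) ^ (x ∸ h))) (suc m ^ x)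
binomProb-formula {m} {x} {y} {h} y≤n h≤x = begin
  frac (x C h) 1 *ℚ (p ^ℚ h *ℚ (ℚ.1ℚ ℚ.- p) ^ℚ b)
    ≡⟨ cong (λ q → frac (x C h) 1 *ℚ (p ^ℚ h *ℚ q ^ℚ b)) (1-frac y≤n) ⟩
  frac (x C h) 1 *ℚ (p ^ℚ h *ℚ frac z n ^ℚ b)
    ≡⟨ cong₂ (λ u v → frac (x C h) 1 *ℚ (u *ℚ v)) (frac-^ y n h) (frac-^ z n b) ⟩
  frac (x C h) 1 *ℚ (frac (y ^ h) (n ^ h) *ℚ frac (z ^ b) (n ^ b))
    ≡⟨ cong (frac (x C h) 1 *ℚ_) (frac-* (y ^ h) (n ^ h) (z ^ b) (n ^ b)) ⟩
  frac (x C h) 1 *ℚ frac (y ^ h * z ^ b) (n ^ h * n ^ b)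
    ≡⟨ frac-scale (x C h) (y ^ h * z ^ b) (n ^ h * n ^ b) ⟩
  frac ((x C h) * (y ^ h * z ^ b)) (n ^ h * n ^ b)
    ≡⟨ cong (frac ((x C h) * (y ^ h * z ^ b))) (trans (sym (^-distribˡ-+-* n h b)) (cong (n ^_) (m+[n∸m]≡n h≤x))) ⟩
  frac ((x C h) * (y ^ h * z ^ b)) (n ^ x) ∎
  where
  open ≡-Reasoning
  n = suc m
  z = n ∸ y
  b = x ∸ h
  p = frac y n

lemma3p2 : (n x y : ℕ) → x ≤ n → y ≤ n →
    (Y : Subset n) → ∣ Y ∣ ≡ y →
    x * x ≤ n →
    (h : ℕ) → h ≤ x →
    hyperProb n x Y h ≤ℚ ((+ 2) / 1) *ℚ binomProb x (frac y n) h
lemma3p2 zero    .0 .0 z≤n z≤n [] refl _ .0 z≤n = frac-mono-≤ {1} {1} {2} {1} (s≤s z≤n) (s≤s z≤n) (s≤s z≤n)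
lemma3p2 n@(suc _) x y x≤n y≤n Y ∣Y∣≡y x*x≤n h h≤x = begin
  hyperProb n x Y h                                     ≡⟨ hyperProb-formula x h Y h≤x ⟩
  frac ((∣ Y ∣ C h) * (∣ ∁ Y ∣ C b)) (n C x)             ≡⟨ cong₂ (λ u v → frac ((u C h) * (v C b)) (n C x)) ∣Y∣≡y ∣∁Y∣≡z ⟩
  frac ((y C h) * (z C b)) (n C x)                       ≤⟨ frac-mono-≤ (nCk>0 x≤n) (m^n>0 n x)
                                                              (hypergeometric≤2*binomial y z h x*x≤n x≤n h≤x) ⟩
  frac (2 * ((x C h) * (y ^ h * z ^ b))) (n ^ x)         ≡⟨ frac-scale 2 _ (n ^ x) ⟨
  frac 2 1 *ℚ frac ((x C h) * (y ^ h * z ^ b)) (n ^ x)   ≡⟨ cong (frac 2 1 *ℚ_) (binomProb-formula y≤n h≤x) ⟨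
  ((+ 2) / 1) *ℚ binomProb x (frac y n) h                ∎
  where
  open ℚ.≤-Reasoning
  z = n ∸ y
  b = x ∸ h
  ∣∁Y∣≡z : ∣ ∁ Y ∣ ≡ z
  ∣∁Y∣≡z = trans (∣∁p∣≡n∸∣p∣ Y) (cong (n ∸_) ∣Y∣≡y)
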